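{- Let $\Sigma$ be a finite alphabet with at least two symbols. There is no algorithm with oracle access which, for every eventually strongly almost periodic sequence $\omega\in\Sigma^{\mathbb{N}}$ and every almost periodicity regulator $f$ of $\omega$, given oracle access to $\omega$ and $f$, halts and outputs a natural number $l\ge\mathrm{pr}(\omega)$.
   Context: For a sequence $\omega$, write $\omega[i,j]=\omega(i)\dots\omega(j)$ and $\omega[i,\infty)$ for the suffix starting at $i$; a factor is a nonempty string $\omega[i,j]$. A sequence is strongly almost periodic (SAP) if for every factor $x$ there is $l$ such that every factor of length $l$ contains an occurrence of $x$; it is eventually strongly almost periodic if some suffix is SAP, and $\mathrm{pr}(\omega)$ is the least $m$ with $\omega[m,\infty)$ SAP. A function $r\colon\mathbb{N}\to\mathbb{N}$ is an almost periodicity regulator of $\omega$ if (1) every string of length $k$ occurring in $\omega$ infinitely many times occurs in every factor of $\omega$ of length $r(k)$, and (2) every string of length $k$ occurring in $\omega$ only finitely many times does not occur in $\omega[r(k),\infty)$. An algorithm with oracle access to $\omega$ and $f$ may query values $\omega(i)$ and $f(i)$ (equivalently, it reads a binary sequence encoding the pair $\langle\omega,f\rangle$). -}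

module Defs where

open import Data.Nat using (ℕ; zero; suc; _+_; _≤_; _<_)
open import Data.Fin using (Fin; toℕ)
open import Data.List using (List; []; _∷_; length; map; upTo)
open import Data.Maybe using (Maybe; just; nothing)
open import Data.Product using (Σ; ∃; _×_; _,_)
open import Relation.Binary.PropositionalEquality using (_≡_)
open import Relation.Nullary using (¬_)
open import Data.Empty using (⊥)

Seq : ℕ → Set
Seq k = ℕ → Fin k

Str : ℕ → Set
Str k = List (Fin k)

OccursAt : {k : ℕ} → Seq k → Str k → ℕ → Set
OccursAt ω x p = map (λ t → ω (p + t)) (upTo (length x)) ≡ x

IsFactor : {k : ℕ} → Seq k → Str k → Set
IsFactor ω [] = ⊥
IsFactor ω x@(_ ∷ _) = ∃ λ p → OccursAt ω x p

OccursInEveryWindow : {k : ℕ} → Seq k → Str k → ℕ → Set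
OccursInEveryWindow ω x l =
  ∀ i → ∃ λ p → (i ≤ p) × (p + length x ≤ i + l) × OccursAt ω x p

SAP : {k : ℕ} → Seq k → Set
SAP ω = ∀ x → IsFactor ω x → ∃ λ l → OccursInEveryWindow ω x l

suffix : {k : ℕ} → Seq k → ℕ → Seq k
suffix ω m n = ω (m + n)

EventuallySAP : {k : ℕ} → Seq k → Set
EventuallySAP ω = ∃ λ m → SAP (suffix ω m)

IsPr : {k : ℕ} → Seq k → ℕ → Set
IsPr ω m = SAP (suffix ω m) × (∀ m' → m' < m → ¬ SAP (suffix ω m'))

InfinitelyOften : {k : ℕ} → Seq k → Str k → Set
InfinitelyOften ω x = ∀ N → ∃ λ p → (N ≤ p) × OccursAt ω x p

IsRegulator : {k : ℕ} → Seq k → (ℕ → ℕ) → Set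
IsRegulator ω r =
  (∀ (x : Str _) → InfinitelyOften ω x → OccursInEveryWindow ω x (r (length x)))
  × (∀ (x : Str _) → ¬ InfinitelyOften ω x → ∀ p → r (length x) ≤ p → ¬ OccursAt ω x p)

-- Oracle algorithms: a strategy maps the history of oracle answers so far
-- (most recent first) to the next action: query ω(i), query f(i), or halt with output.
data Action : Set where
  queryω : ℕ → Action
  queryf : ℕ → Action
  halt   : ℕ → Action

OracleAlgorithm : Set
OracleAlgorithm = List ℕ → Action

run : OracleAlgorithm → (ℕ → ℕ) → (ℕ → ℕ) → ℕ → List ℕ → Maybe ℕ
run A a b zero h = nothing
run A a b (suc n) h with A h
... | queryω i = run A a b n (a i ∷ h)
... | queryf i = run A a b n (b i ∷ h)
... | halt l   = just l

HaltsWith : {k : ℕ} → OracleAlgorithm → Seq k → (ℕ → ℕ) → ℕ → Set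
HaltsWith A ω f l = ∃ λ fuel → run A (λ i → toℕ (ω i)) f fuel [] ≡ just l

-- The period-doubling sequence pd (pd (2m) = 0, pd (2m+1) = ¬ pd m) is uniformly
-- recurrent: every factor of length L recurs in every window of length 2^(3+L).
-- Flipping the bit of pd at position 3·2^J − 1 creates a block that never occurs in
-- pd again, so the perturbed sequence is SAP from just after the flip but from no
-- position ≤ 2^J.  Its windows of length ≤ 2^J are still windows of pd, so 2^(3+L)
-- remains a valid regulator value for words of length L ≤ J − 3, and longer words
-- get that bound shifted past the flip.  An algorithm that halts on pd and its
-- regulator with output l, having queried only arguments below b, therefore gives
-- the same answer on the perturbation with J = 3 + b + l, whose pr exceeds b + l.

module Submission where

open import Defs
open import Data.Nat using (ℕ; _≤_)
open import Data.Product using (Σ; ∃; _×_)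
open import Relation.Nullary using (¬_)

open import Data.Nat
  using (NonZero; zero; suc; _+_; _*_; _∸_; _^_; _<_; _⊔_; z≤n; s≤s; z<s; s<s; _≤?_; _<?_; _≟_)
open import Data.Nat.Properties
open import Data.Nat.Tactic.RingSolver using (solve-∀)
open import Data.Nat.DivMod using (_/_; _%_; m≡m%n+[m/n]*n; m%n<n; m/n*n≤m)
open import Data.List using (List; []; _∷_; length; map; upTo; applyUpTo)
open import Data.List.Properties using (∷-injectiveˡ; ∷-injectiveʳ; length-applyUpTo; map-upTo)
open import Data.Product using (_,_; proj₁; proj₂)
open import Data.Sum using (_⊎_; inj₁; inj₂; [_,_]′)
open import Data.Bool using (Bool; true; false; not)
open import Data.Bool.Properties using (not-involutive; not-injective)
open import Data.Empty using (⊥; ⊥-elim)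
open import Data.Fin as Fin using (Fin; toℕ)
open import Data.Maybe using (just)
open import Data.Maybe.Properties using (just-injective)
open import Data.Nat.Induction using (<-rec)
open import Function using (_∘_)
open import Relation.Nullary using (yes; no)
open import Relation.Binary.PropositionalEquality hiding (J)

private
  variable
    k : ℕ

applyUpTo-cong : ∀ {A : Set} {f g : ℕ → A} n →
  (∀ t → t < n → f t ≡ g t) → applyUpTo f n ≡ applyUpTo g n
applyUpTo-cong zero    _  = refl
applyUpTo-cong (suc n) eq = cong₂ _∷_ (eq 0 z<s) (applyUpTo-cong n (λ t t<n → eq (suc t) (s<s t<n)))

applyUpTo-injective : ∀ {A : Set} {f g : ℕ → A} n →
  applyUpTo f n ≡ applyUpTo g n → ∀ t → t < n → f t ≡ g t
applyUpTo-injective (suc n) eq zero    _         = ∷-injectiveˡ eq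
applyUpTo-injective (suc n) eq (suc t) (s<s t<n) = applyUpTo-injective n (∷-injectiveʳ eq) t t<n

window : Seq k → ℕ → ℕ → Str k
window ω p n = applyUpTo (λ t → ω (p + t)) n

occursAt-window : ∀ (ω : Seq k) p n → OccursAt ω (window ω p n) p
occursAt-window ω p n rewrite length-applyUpTo (λ t → ω (p + t)) n = map-upTo (λ t → ω (p + t)) n

occursAt-transport : ∀ (u v : Seq k) x p q →
  (∀ t → t < length x → u (p + t) ≡ v (q + t)) → OccursAt u x p → OccursAt v x q
occursAt-transport u v x p q eq o = begin
  map (λ t → v (q + t)) (upTo (length x)) ≡⟨ map-upTo _ (length x) ⟩
  window v q (length x)                   ≡⟨ applyUpTo-cong (length x) (λ t t<n → sym (eq t t<n)) ⟩
  window u p (length x)                   ≡⟨ sym (map-upTo _ (length x)) ⟩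
  map (λ t → u (p + t)) (upTo (length x)) ≡⟨ o ⟩
  x                                       ∎
  where open ≡-Reasoning

occursAt-agree : ∀ (u v : Seq k) x p q → OccursAt u x p → OccursAt v x q →
  ∀ t → t < length x → u (p + t) ≡ v (q + t)
occursAt-agree u v x p q o o' = applyUpTo-injective (length x)
  (trans (sym (map-upTo _ (length x))) (trans (trans o (sym o')) (map-upTo _ (length x))))

occursAt-suffix⇒ : ∀ (ω : Seq k) x m p → OccursAt (suffix ω m) x p → OccursAt ω x (m + p)
occursAt-suffix⇒ ω x m p =
  occursAt-transport (suffix ω m) ω x p (m + p) (λ t _ → cong ω (sym (+-assoc m p t)))

occursAt⇒suffix : ∀ (ω : Seq k) x m p → OccursAt ω x (m + p) → OccursAt (suffix ω m) x p
occursAt⇒suffix ω x m p =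
  occursAt-transport ω (suffix ω m) x (m + p) p (λ t _ → cong ω (+-assoc m p t))

occursWithin-transport : ∀ (u v : Seq k) x i i' W →
  (∀ t → t < W → v (i + t) ≡ u (i' + t)) →
  (∃ λ q → i' ≤ q × q + length x ≤ i' + W × OccursAt u x q) →
  (∃ λ q → i ≤ q × q + length x ≤ i + W × OccursAt v x q)
occursWithin-transport u v x i i' W v≡u (q , i'≤q , q+∣x∣≤ , o)
  with m≤n⇒∃[o]m+o≡n i'≤q
... | d , refl = i + d , m≤m+n i d , i+d+∣x∣≤ , occursAt-transport u v x (i' + d) (i + d) u≡v o
  where
  d+∣x∣≤W : d + length x ≤ W
  d+∣x∣≤W = +-cancelˡ-≤ i' _ _ (subst (_≤ i' + W) (+-assoc i' d (length x)) q+∣x∣≤)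
  i+d+∣x∣≤ : i + d + length x ≤ i + W
  i+d+∣x∣≤ = subst (_≤ i + W) (sym (+-assoc i d (length x))) (+-monoʳ-≤ i d+∣x∣≤W)
  u≡v : ∀ t → t < length x → u (i' + d + t) ≡ v (i + d + t)
  u≡v t t<∣x∣ = begin
    u (i' + d + t)   ≡⟨ cong u (+-assoc i' d t) ⟩
    u (i' + (d + t)) ≡⟨ sym (v≡u (d + t) (<-≤-trans (+-monoʳ-< d t<∣x∣) d+∣x∣≤W)) ⟩
    v (i + (d + t))  ≡⟨ cong v (sym (+-assoc i d t)) ⟩
    v (i + d + t)    ∎
    where open ≡-Reasoning

UniformlyRecurrent : Seq k → (ℕ → ℕ) → Set
UniformlyRecurrent ω R = ∀ x p → OccursAt ω x p → OccursInEveryWindow ω x (R (length x))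

module _ {ω : Seq k} {R : ℕ → ℕ} (recurrent : UniformlyRecurrent ω R) where

  recurrent⇒infinitelyOften : ∀ x p → OccursAt ω x p → InfinitelyOften ω x
  recurrent⇒infinitelyOften x p o N with recurrent x p o N
  ... | q , N≤q , _ , o' = q , N≤q , o'

  recurrent⇒isRegulator : IsRegulator ω R
  recurrent⇒isRegulator =
    (λ x io → let (p , _ , o) = io 0 in recurrent x p o) ,
    (λ x ¬io p _ o → ¬io (recurrent⇒infinitelyOften x p o))

  recurrent⇒SAP : SAP ω
  recurrent⇒SAP (_ ∷ _) (p , o) = R _ , recurrent _ p o

  recurrent-suffix : ∀ m → UniformlyRecurrent (suffix ω m) R
  recurrent-suffix m x p o i with recurrent x (m + p) (occursAt-suffix⇒ ω x m p o) (m + i)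
  ... | q , m+i≤q , q+∣x∣≤ , o' with m≤n⇒∃[o]m+o≡n (≤-trans (m≤m+n m i) m+i≤q)
  ...   | d , refl = d , +-cancelˡ-≤ m i d m+i≤q ,
                     +-cancelˡ-≤ m _ _ (subst₂ _≤_ (+-assoc m d _) (+-assoc m i _) q+∣x∣≤) ,
                     occursAt⇒suffix ω x m d o'

recurrent-cong : ∀ {u v : Seq k} {R} → (∀ n → u n ≡ v n) →
  UniformlyRecurrent u R → UniformlyRecurrent v R
recurrent-cong {u = u} {v} u≗v recurrent x p o i
  with recurrent x p (occursAt-transport v u x p p (λ t _ → sym (u≗v (p + t))) o) i
... | q , i≤q , q+∣x∣≤ , o' =
  q , i≤q , q+∣x∣≤ , occursAt-transport u v x q q (λ t _ → u≗v (q + t)) o'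

¬SAP-transient : ∀ (ω : Seq k) m D x → IsFactor (suffix ω m) x →
  (∀ q → D < q → ¬ OccursAt ω x q) → ¬ SAP (suffix ω m)
¬SAP-transient ω m D x factor transient sap with sap x factor
... | l , everyWindow with everyWindow (suc D)
...   | p , D<p , _ , o = transient (m + p) (≤-trans D<p (m≤n+m p m)) (occursAt-suffix⇒ ω x m p o)

module Perturbation {u v : Seq k} {R : ℕ → ℕ} {D N B : ℕ}
  (u-recurrent : UniformlyRecurrent u R)
  (v≡u-beyond : ∀ n → D < n → v n ≡ u n)
  (short-windows : ∀ i W → W ≤ B → ∃ λ i' → ∀ t → t < W → v (i + t) ≡ u (i' + t))
  (N≤B : N ≤ B) (R≤B : ∀ L → L ≤ N → R L ≤ B)
  where

  regulator : ℕ → ℕ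
  regulator L with L ≤? N
  ... | yes _ = R L
  ... | no  _ = suc D + R L

  regulator-short : ∀ L → L ≤ N → regulator L ≡ R L
  regulator-short L L≤N with L ≤? N
  ... | yes _   = refl
  ... | no  L≰N = ⊥-elim (L≰N L≤N)

  occursAt-beyond⇒u : ∀ x p → D < p → OccursAt v x p → OccursAt u x p
  occursAt-beyond⇒u x p D<p = occursAt-transport v u x p p
    (λ t _ → v≡u-beyond (p + t) (≤-trans D<p (m≤m+n p t)))

  occursAt-beyond⇒v : ∀ x p → D < p → OccursAt u x p → OccursAt v x p
  occursAt-beyond⇒v x p D<p = occursAt-transport u v x p p
    (λ t _ → sym (v≡u-beyond (p + t) (≤-trans D<p (m≤m+n p t))))

  occursAt-u⇒infinitelyOften-v : ∀ x p → OccursAt u x p → InfinitelyOften v x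
  occursAt-u⇒infinitelyOften-v x p o n with u-recurrent x p o (n + suc D)
  ... | q , n+D<q , _ , o' =
    q , ≤-trans (m≤m+n n _) n+D<q , occursAt-beyond⇒v x q (≤-trans (m≤n+m (suc D) n) n+D<q) o'

  short-occursAt⇒u : ∀ x p → length x ≤ B → OccursAt v x p → ∃ λ q → OccursAt u x q
  short-occursAt⇒u x p ∣x∣≤B o with short-windows p (length x) ∣x∣≤B
  ... | q , v≡u = q , occursAt-transport v u x p q v≡u o

  isRegulator : IsRegulator v regulator
  isRegulator = recurring , transient
    where
    recurring : ∀ x → InfinitelyOften v x → OccursInEveryWindow v x (regulator (length x))
    recurring x io i with io (suc D) | length x ≤? N
    ... | p , D<p , o | yes ∣x∣≤N with short-windows i (R (length x)) (R≤B _ ∣x∣≤N)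
    ...   | i' , v≡u = occursWithin-transport u v x i i' (R (length x)) v≡u
                         (u-recurrent x p (occursAt-beyond⇒u x p D<p o) i')
    recurring x io i | p , D<p , o | no _
      with u-recurrent x p (occursAt-beyond⇒u x p D<p o) (i + suc D)
    ... | q , i+D<q , q+∣x∣≤ , o' =
      q , ≤-trans (m≤m+n i _) i+D<q , subst (q + length x ≤_) (+-assoc i (suc D) _) q+∣x∣≤ ,
      occursAt-beyond⇒v x q (≤-trans (m≤n+m (suc D) i) i+D<q) o'

    transient : ∀ x → ¬ InfinitelyOften v x → ∀ p → regulator (length x) ≤ p → ¬ OccursAt v x p
    transient x ¬io p reg≤p o with length x ≤? N
    ... | yes ∣x∣≤N = let (q , o') = short-occursAt⇒u x p (≤-trans ∣x∣≤N N≤B) o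
                      in ¬io (occursAt-u⇒infinitelyOften-v x q o')
    ... | no _ = ¬io (occursAt-u⇒infinitelyOften-v x p
                       (occursAt-beyond⇒u x p (≤-trans (m≤m+n (suc D) _) reg≤p) o))

  suffix-SAP : SAP (suffix v (suc D))
  suffix-SAP = recurrent⇒SAP {R = R} (recurrent-cong {u = suffix u (suc D)} {R = R}
    (λ n → sym (v≡u-beyond (suc D + n) (s≤s (m≤m+n D n))))
    (recurrent-suffix {ω = u} {R = R} u-recurrent (suc D)))

queryBound : OracleAlgorithm → (ℕ → ℕ) → (ℕ → ℕ) → ℕ → List ℕ → ℕ
queryBound A a b zero    h = 0
queryBound A a b (suc n) h with A h
... | queryω i = suc i ⊔ queryBound A a b n (a i ∷ h)
... | queryf i = suc i ⊔ queryBound A a b n (b i ∷ h)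
... | halt _   = 0

run-cong : ∀ A a b a' b' n h →
  (∀ i → i < queryBound A a b n h → a i ≡ a' i) →
  (∀ i → i < queryBound A a b n h → b i ≡ b' i) →
  run A a b n h ≡ run A a' b' n h
run-cong A a b a' b' zero    h _ _ = refl
run-cong A a b a' b' (suc n) h a≡a' b≡b' with A h
... | queryω i = trans
  (run-cong A a b a' b' n (a i ∷ h)
    (λ j → a≡a' j ∘ m≤n⇒m≤o⊔n (suc i)) (λ j → b≡b' j ∘ m≤n⇒m≤o⊔n (suc i)))
  (cong (λ z → run A a' b' n (z ∷ h)) (a≡a' i (m≤m⊔n (suc i) (queryBound A a b n (a i ∷ h)))))
... | queryf i = trans
  (run-cong A a b a' b' n (b i ∷ h)
    (λ j → a≡a' j ∘ m≤n⇒m≤o⊔n (suc i)) (λ j → b≡b' j ∘ m≤n⇒m≤o⊔n (suc i)))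
  (cong (λ z → run A a' b' n (z ∷ h)) (b≡b' i (m≤m⊔n (suc i) (queryBound A a b n (b i ∷ h)))))
... | halt _ = refl

run-deterministic : ∀ A a b n n' h {x y} → run A a b n h ≡ just x → run A a b n' h ≡ just y → x ≡ y
run-deterministic A a b (suc n) (suc n') h r r' with A h
... | queryω i = run-deterministic A a b n n' (a i ∷ h) r r'
... | queryf i = run-deterministic A a b n n' (b i ∷ h) r r'
... | halt _   = just-injective (trans (sym r) r')

HaltsWith-functional : ∀ {A} {ω : Seq k} {f l l'} → HaltsWith A ω f l → HaltsWith A ω f l' → l ≡ l'
HaltsWith-functional {A = A} {ω} {f} (n , r) (n' , r') =
  run-deterministic A (λ i → toℕ (ω i)) f n n' [] r r'

HaltsWith-local : ∀ {A} {ω : Seq k} {f l} → HaltsWith A ω f l →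
  ∃ λ b → ∀ (ω' : Seq k) f' → (∀ i → i < b → ω i ≡ ω' i) → (∀ i → i < b → f i ≡ f' i) →
    HaltsWith A ω' f' l
HaltsWith-local {A = A} {ω} {f} (n , r) =
  queryBound A (λ i → toℕ (ω i)) f n [] , λ ω' f' ω≡ω' f≡f' →
    n , trans (sym (run-cong A _ f _ f' n [] (λ i → cong toℕ ∘ ω≡ω' i) f≡f')) r

¬¬-least : ∀ {P : ℕ → Set} n → P n → ¬ ¬ (∃ λ m → P m × (∀ m' → m' < m → ¬ P m'))
¬¬-least {P} n pn ¬least = ¬P n pn
  where
  ¬P : ∀ n → ¬ P n
  ¬P = <-rec (λ n → ¬ P n) (λ m ¬P< pm → ¬least (m , pm , λ m' m'<m → ¬P< m'<m))

double : ℕ → ℕ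
double zero    = zero
double (suc m) = suc (suc (double m))

2*≡double : ∀ m → 2 * m ≡ double m
2*≡double zero    = refl
2*≡double (suc m) = cong suc (trans (+-suc m (m + 0)) (cong suc (2*≡double m)))

double-+ : ∀ m n → double (m + n) ≡ double m + double n
double-+ zero    n = refl
double-+ (suc m) n = cong (suc ∘ suc) (double-+ m n)

double-injective : ∀ {m n} → double m ≡ double n → m ≡ n
double-injective {zero}  {zero}  _  = refl
double-injective {suc m} {suc n} eq = cong suc (double-injective (suc-injective (suc-injective eq)))

double≢1+double : ∀ m n → double m ≢ suc (double n)
double≢1+double (suc m) (suc n) eq = double≢1+double m n (suc-injective (suc-injective eq))

double-mono-≤ : ∀ {m n} → m ≤ n → double m ≤ double n
double-mono-≤ z≤n       = z≤n
double-mono-≤ (s≤s m≤n) = s≤s (s≤s (double-mono-≤ m≤n))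

double-cancel-≤ : ∀ m n → double m ≤ suc (double n) → m ≤ n
double-cancel-≤ zero    n       _                 = z≤n
double-cancel-≤ (suc m) (suc n) (s≤s (s≤s le)) = s≤s (double-cancel-≤ m n le)

m≤double : ∀ m → m ≤ double m
m≤double zero    = z≤n
m≤double (suc m) = s≤s (m≤n⇒m≤1+n (m≤double m))

evenOrOdd : ∀ n → (∃ λ m → n ≡ double m) ⊎ (∃ λ m → n ≡ suc (double m))
evenOrOdd zero          = inj₁ (0 , refl)
evenOrOdd (suc zero)    = inj₂ (0 , refl)
evenOrOdd (suc (suc n)) with evenOrOdd n
... | inj₁ (m , refl) = inj₁ (suc m , refl)
... | inj₂ (m , refl) = inj₂ (suc m , refl)

-- Fuel suc n suffices since the recursion halves its argument; outside this block
-- pd is used only through pd-double and pd-1+double.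
opaque
  pdWithin : ℕ → ℕ → Bool
  pdWithin zero       _ = false
  pdWithin (suc fuel) n with evenOrOdd n
  ... | inj₁ _       = false
  ... | inj₂ (m , _) = not (pdWithin fuel m)

  pdWithin-stable : ∀ f f' n → n < f → n < f' → pdWithin f n ≡ pdWithin f' n
  pdWithin-stable (suc f) (suc f') n (s≤s n≤f) (s≤s n≤f') with evenOrOdd n
  ... | inj₁ _          = refl
  ... | inj₂ (m , refl) = cong not (pdWithin-stable f f' m
                            (<-≤-trans (s≤s (m≤double m)) n≤f) (<-≤-trans (s≤s (m≤double m)) n≤f'))

  pd : ℕ → Bool
  pd n = pdWithin (suc n) n

  pd-double : ∀ m → pd (double m) ≡ false
  pd-double m with evenOrOdd (double m)
  ... | inj₁ _        = refl
  ... | inj₂ (m' , e) = ⊥-elim (double≢1+double m m' e)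

  pd-1+double : ∀ m → pd (suc (double m)) ≡ not (pd m)
  pd-1+double m with evenOrOdd (suc (double m))
  ... | inj₁ (m' , e) = ⊥-elim (double≢1+double m' m (sym e))
  ... | inj₂ (m' , e) with double-injective (suc-injective e)
  ...   | refl = cong not (pdWithin-stable (suc (double m)) (suc m) m (s≤s (m≤double m)) ≤-refl)

pd-no-11 : ∀ n → pd n ≡ true → pd (suc n) ≡ true → ⊥
pd-no-11 n pdn≡true pd1+n≡true = [ even , odd ]′ (evenOrOdd n)
  where
  even : ∃ (λ m → n ≡ double m) → ⊥
  even (m , refl) with () ← trans (sym (pd-double m)) pdn≡true
  odd : ∃ (λ m → n ≡ suc (double m)) → ⊥
  odd (m , refl) with () ← trans (sym (pd-double (suc m))) pd1+n≡true

ones : ℕ → ℕ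
ones zero    = zero
ones (suc j) = suc (double (ones j))

1+ones≡2^ : ∀ j → suc (ones j) ≡ 2 ^ j
1+ones≡2^ zero    = refl
1+ones≡2^ (suc j) = trans (cong double (1+ones≡2^ j)) (sym (2*≡double (2 ^ j)))

n≤ones : ∀ n → n ≤ ones n
n≤ones zero    = z≤n
n≤ones (suc n) = s≤s (≤-trans (n≤ones n) (m≤double (ones n)))

n<2^n : ∀ n → n < 2 ^ n
n<2^n n = subst (n <_) (1+ones≡2^ n) (s≤s (n≤ones n))

double≡+ : ∀ m → double m ≡ m + m
double≡+ m = trans (sym (2*≡double m)) (cong (m +_) (+-identityʳ m))

block-zero : ∀ a → 2 ^ 0 * a + 0 ≡ a
block-zero a = trans (+-identityʳ _) (*-identityˡ a)

block-double : ∀ j a s → 2 ^ suc j * a + double s ≡ double (2 ^ j * a + s)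
block-double j a s = begin
  2 * 2 ^ j * a + double s      ≡⟨ cong (_+ double s) (*-assoc 2 (2 ^ j) a) ⟩
  2 * (2 ^ j * a) + double s    ≡⟨ cong (_+ double s) (2*≡double (2 ^ j * a)) ⟩
  double (2 ^ j * a) + double s ≡⟨ sym (double-+ (2 ^ j * a) s) ⟩
  double (2 ^ j * a + s)        ∎
  where open ≡-Reasoning

double+1+double : ∀ m n → double m + suc (double n) ≡ suc (double (m + n))
double+1+double m n = trans (+-suc (double m) (double n)) (cong suc (sym (double-+ m n)))

block-1+double : ∀ j a s → 2 ^ suc j * a + suc (double s) ≡ suc (double (2 ^ j * a + s))
block-1+double j a s = trans (+-suc _ (double s)) (cong suc (block-double j a s))

pd-block : ∀ j a a' s → s ≤ double (ones j) → (s ≡ ones j → pd a ≡ pd a') →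
  pd (2 ^ j * a + s) ≡ pd (2 ^ j * a' + s)
pd-block zero a a' zero _ pd≡ =
  trans (cong pd (block-zero a)) (trans (pd≡ refl) (cong pd (sym (block-zero a'))))
pd-block (suc j) a a' s s≤ pd≡ with evenOrOdd s
... | inj₁ (s' , refl) = begin
  pd (2 ^ suc j * a + double s')    ≡⟨ cong pd (block-double j a s') ⟩
  pd (double (2 ^ j * a + s'))      ≡⟨ pd-double (2 ^ j * a + s') ⟩
  false                             ≡⟨ sym (pd-double (2 ^ j * a' + s')) ⟩
  pd (double (2 ^ j * a' + s'))     ≡⟨ cong pd (sym (block-double j a' s')) ⟩
  pd (2 ^ suc j * a' + double s')   ∎
  where open ≡-Reasoning
... | inj₂ (s' , refl) = begin
  pd (2 ^ suc j * a + suc (double s'))  ≡⟨ cong pd (block-1+double j a s') ⟩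
  pd (suc (double (2 ^ j * a + s')))    ≡⟨ pd-1+double (2 ^ j * a + s') ⟩
  not (pd (2 ^ j * a + s'))             ≡⟨ cong not (pd-block j a a' s' s'≤ (pd≡ ∘ cong (suc ∘ double))) ⟩
  not (pd (2 ^ j * a' + s'))            ≡⟨ sym (pd-1+double (2 ^ j * a' + s')) ⟩
  pd (suc (double (2 ^ j * a' + s')))   ≡⟨ cong pd (sym (block-1+double j a' s')) ⟩
  pd (2 ^ suc j * a' + suc (double s')) ∎
  where
  open ≡-Reasoning
  s'≤ : s' ≤ double (ones j)
  s'≤ = double-cancel-≤ s' (double (ones j)) (≤-pred s≤)

pd-block-flip : ∀ j a a' → pd a ≡ not (pd a') →
  pd (2 ^ j * a + ones j) ≡ not (pd (2 ^ j * a' + ones j))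
pd-block-flip zero a a' flip =
  trans (cong pd (block-zero a)) (trans flip (cong (not ∘ pd) (sym (block-zero a'))))
pd-block-flip (suc j) a a' flip = begin
  pd (2 ^ suc j * a + ones (suc j))         ≡⟨ cong pd (block-1+double j a (ones j)) ⟩
  pd (suc (double (2 ^ j * a + ones j)))    ≡⟨ pd-1+double (2 ^ j * a + ones j) ⟩
  not (pd (2 ^ j * a + ones j))             ≡⟨ cong not (pd-block-flip j a a' flip) ⟩
  not (not (pd (2 ^ j * a' + ones j)))      ≡⟨ cong not (sym (pd-1+double (2 ^ j * a' + ones j))) ⟩
  not (pd (suc (double (2 ^ j * a' + ones j)))) ≡⟨ cong (not ∘ pd) (sym (block-1+double j a' (ones j))) ⟩
  not (pd (2 ^ suc j * a' + ones (suc j)))  ∎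
  where open ≡-Reasoning

divMod : ∀ n .{{_ : NonZero n}} p → ∃ λ q → ∃ λ r → r < n × p ≡ n * q + r
divMod n p = p / n , p % n , m%n<n p n ,
  trans (m≡m%n+[m/n]*n p n) (trans (+-comm (p % n) _) (cong (_+ p % n) (*-comm (p / n) n)))

multiple-within : ∀ n .{{_ : NonZero n}} w → ∃ λ m → w ≤ m * n × m * n ≤ w + n
multiple-within n w =
  suc (w / n) , w≤ , subst (n + w / n * n ≤_) (+-comm n w) (+-monoʳ-≤ n (m/n*n≤m w n))
  where
  w≤ : w ≤ suc (w / n) * n
  w≤ = subst (_≤ n + w / n * n) (sym (m≡m%n+[m/n]*n w n))
         (<⇒≤ (+-monoˡ-< (w / n * n) (m%n<n w n)))

pd-hits : ∀ m b → ∃ λ e → e ≤ 1 × pd (double (double m) + e) ≡ b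
pd-hits m false = 0 , z≤n , trans (cong pd (+-identityʳ _)) (pd-double (double m))
pd-hits m true  = 1 , ≤-refl , (begin
  pd (double (double m) + 1)   ≡⟨ cong pd (+-comm (double (double m)) 1) ⟩
  pd (suc (double (double m))) ≡⟨ pd-1+double (double m) ⟩
  not (pd (double m))          ≡⟨ cong not (pd-double m) ⟩
  true                         ∎)
  where open ≡-Reasoning

block-in-window : ∀ K m e r L w → e ≤ 1 → r < K → L < K →
  w ≤ m * (2 * (2 * K)) → m * (2 * (2 * K)) ≤ w + 2 * (2 * K) →
  w ≤ K * (double (double m) + e) + r × K * (double (double m) + e) + r + L ≤ w + 2 * (2 * (2 * K))
block-in-window K m e r L w e≤1 r<K L<K w≤mM mM≤w+M =
  subst (w ≤_) (sym p'≡) (≤-trans w≤mM (m≤m+n (m * M) _)) , (begin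
    K * a + r + L               ≡⟨ cong (_+ L) p'≡ ⟩
    m * M + (K * e + r) + L     ≡⟨ +-assoc (m * M) _ L ⟩
    m * M + (K * e + r + L)     ≤⟨ +-mono-≤ mM≤w+M (+-mono-≤ (+-mono-≤ Ke≤K (<⇒≤ r<K)) (<⇒≤ L<K)) ⟩
    w + M + (K + K + K)         ≤⟨ +-monoʳ-≤ (w + M) (+-monoʳ-≤ (K + K) (m≤m+n K K)) ⟩
    w + M + (K + K + (K + K))   ≡⟨ shape w K ⟩
    w + 2 * M                   ∎)
  where
  open ≤-Reasoning
  M a : ℕ
  M = 2 * (2 * K)
  a = double (double m) + e
  p'≡ : K * a + r ≡ m * M + (K * e + r)
  p'≡ = begin-equality
    K * (double (double m) + e) + r ≡⟨ cong (λ z → K * (z + e) + r) (sym (2*≡double (double m))) ⟩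
    K * (2 * double m + e) + r      ≡⟨ cong (λ z → K * (2 * z + e) + r) (sym (2*≡double m)) ⟩
    K * (2 * (2 * m) + e) + r       ≡⟨ regroup K m e r ⟩
    m * M + (K * e + r)             ∎
    where
    regroup : ∀ K m e r → K * (2 * (2 * m) + e) + r ≡ m * (2 * (2 * K)) + (K * e + r)
    regroup = solve-∀
  Ke≤K : K * e ≤ K
  Ke≤K = subst (K * e ≤_) (*-identityʳ K) (*-monoʳ-≤ K e≤1)
  shape : ∀ w K → w + 2 * (2 * K) + (K + K + (K + K)) ≡ w + 2 * (2 * (2 * K))
  shape = solve-∀

-- Take p' ≡ p modulo 2^L inside a block 2^L·a just after w, where a ∈ {4m, 4m+1}
-- is chosen with the same pd-bit as p / 2^L.
pd-recurrent : ∀ L p w → ∃ λ p' → w ≤ p' × p' + L ≤ w + 2 ^ (3 + L) ×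
  (∀ t → t < L → pd (p' + t) ≡ pd (p + t))
pd-recurrent L p w
  with divMod (2 ^ L) {{m^n≢0 2 L}} p | multiple-within (2 ^ (2 + L)) {{m^n≢0 2 (2 + L)}} w
... | q , r , r<K , refl | m , w≤mM , mM≤w+M with pd-hits m (pd q)
... | e , e≤1 , pd-a≡pd-q = K * a + r , proj₁ inWindow , proj₂ inWindow , agree
  where
  K a : ℕ
  K = 2 ^ L
  a = double (double m) + e
  inWindow : w ≤ K * a + r × K * a + r + L ≤ w + 2 ^ (3 + L)
  inWindow = block-in-window K m e r L w e≤1 r<K (n<2^n L) w≤mM mM≤w+M
  agree : ∀ t → t < L → pd (K * a + r + t) ≡ pd (K * q + r + t)
  agree t t<L = begin
    pd (K * a + r + t)   ≡⟨ cong pd (+-assoc (K * a) r t) ⟩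
    pd (K * a + (r + t)) ≡⟨ pd-block L a q (r + t) r+t≤ (λ _ → pd-a≡pd-q) ⟩
    pd (K * q + (r + t)) ≡⟨ cong pd (sym (+-assoc (K * q) r t)) ⟩
    pd (K * q + r + t)   ∎
    where
    open ≡-Reasoning
    r≤ones : r ≤ ones L
    r≤ones = ≤-pred (subst (suc r ≤_) (sym (1+ones≡2^ L)) r<K)
    r+t≤ : r + t ≤ double (ones L)
    r+t≤ = subst (r + t ≤_) (sym (double≡+ (ones L)))
             (+-mono-≤ r≤ones (≤-trans (<⇒≤ t<L) (n≤ones L)))

pd-1 : pd 1 ≡ true
pd-1 = trans (pd-1+double 0) (cong not (pd-double 0))

pd-2≡not-pd-1 : pd 2 ≡ not (pd 1)
pd-2≡not-pd-1 = trans (pd-double 1) (cong not (sym pd-1))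

defect : ℕ → ℕ
defect J = 2 ^ J * 2 + ones J

perturbed : ℕ → ℕ → Bool
perturbed J n with n ≟ defect J
... | yes _ = not (pd n)
... | no  _ = pd n

perturbed-≢ : ∀ J n → n ≢ defect J → perturbed J n ≡ pd n
perturbed-≢ J n n≢ with n ≟ defect J
... | yes n≡ = ⊥-elim (n≢ n≡)
... | no  _  = refl

perturbed-defect : ∀ J → perturbed J (defect J) ≡ not (pd (defect J))
perturbed-defect J with defect J ≟ defect J
... | yes _ = refl
... | no  ≢ = ⊥-elim (≢ refl)

defect-suc : ∀ J → defect (suc J) ≡ suc (double (defect J))
defect-suc J = block-1+double J 2 (ones J)

1≤defect : ∀ J → 1 ≤ defect J
1≤defect J = ≤-trans (m^n>0 2 J) (≤-trans (m≤m*n (2 ^ J) 2) (m≤m+n (2 ^ J * 2) (ones J)))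

perturbed-double : ∀ J m → perturbed (suc J) (double m) ≡ false
perturbed-double J m = trans
  (perturbed-≢ (suc J) (double m) (λ eq → double≢1+double m (defect J) (trans eq (defect-suc J))))
  (pd-double m)

perturbed-1+double : ∀ J m → perturbed (suc J) (suc (double m)) ≡ not (perturbed J m)
perturbed-1+double J m with m ≟ defect J
... | yes refl = begin
  perturbed (suc J) (suc (double (defect J))) ≡⟨ cong (perturbed (suc J)) (sym (defect-suc J)) ⟩
  perturbed (suc J) (defect (suc J))          ≡⟨ perturbed-defect (suc J) ⟩
  not (pd (defect (suc J)))                   ≡⟨ cong (not ∘ pd) (defect-suc J) ⟩
  not (pd (suc (double (defect J))))          ≡⟨ cong not (pd-1+double (defect J)) ⟩
  not (not (pd (defect J)))                   ∎
  where open ≡-Reasoning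
... | no m≢ = trans
  (perturbed-≢ (suc J) _ (λ eq → m≢ (double-injective (suc-injective (trans eq (defect-suc J))))))
  (pd-1+double m)

perturbed-copies : ∀ J s → s ≤ double (ones J) → perturbed J (2 ^ J * 2 + s) ≡ pd (2 ^ J * 1 + s)
perturbed-copies J s s≤ with s ≟ ones J
... | yes refl = begin
  perturbed J (defect J)              ≡⟨ perturbed-defect J ⟩
  not (pd (defect J))                 ≡⟨ cong not (pd-block-flip J 2 1 pd-2≡not-pd-1) ⟩
  not (not (pd (2 ^ J * 1 + ones J))) ≡⟨ not-involutive _ ⟩
  pd (2 ^ J * 1 + ones J)             ∎
  where open ≡-Reasoning
... | no s≢ = trans
  (perturbed-≢ J _ (s≢ ∘ +-cancelˡ-≡ (2 ^ J * 2) s (ones J)))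
  (pd-block J 2 1 s s≤ (⊥-elim ∘ s≢))

-- A short window that meets the defect lies in [2·2^J, 4·2^J − 2], where the
-- perturbed sequence is pd shifted by 2^J.
perturbed-windows : ∀ J i W → W ≤ 2 ^ J →
  ∃ λ i' → ∀ t → t < W → perturbed J (i + t) ≡ pd (i' + t)
perturbed-windows J i W W≤K with defect J <? i | i + W ≤? defect J
... | yes defect<i | _ = i , λ t _ → perturbed-≢ J (i + t) (>⇒≢ (≤-trans defect<i (m≤m+n i t)))
... | no _ | yes i+W≤defect =
  i , λ t t<W → perturbed-≢ J (i + t) (<⇒≢ (≤-trans (+-monoʳ-< i t<W) i+W≤defect))
... | no defect≮i | no i+W≰defect with m≤n⇒∃[o]m+o≡n 2K≤i
  where
  K : ℕ
  K = 2 ^ J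
  2K≤i : K * 2 ≤ i
  2K≤i = +-cancelʳ-≤ K (K * 2) i (begin
    K * 2 + K          ≡⟨ cong (K * 2 +_) (sym (1+ones≡2^ J)) ⟩
    K * 2 + suc (ones J) ≡⟨ +-suc (K * 2) (ones J) ⟩
    suc (defect J)     ≤⟨ ≰⇒> i+W≰defect ⟩
    i + W              ≤⟨ +-monoʳ-≤ i W≤K ⟩
    i + K              ∎)
    where open ≤-Reasoning
... | s , refl = 2 ^ J * 1 + s , shifted
  where
  s≤ones : s ≤ ones J
  s≤ones = +-cancelˡ-≤ (2 ^ J * 2) s (ones J) (≮⇒≥ defect≮i)
  shifted : ∀ t → t < W → perturbed J (2 ^ J * 2 + s + t) ≡ pd (2 ^ J * 1 + s + t)
  shifted t t<W = begin
    perturbed J (2 ^ J * 2 + s + t)   ≡⟨ cong (perturbed J) (+-assoc (2 ^ J * 2) s t) ⟩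
    perturbed J (2 ^ J * 2 + (s + t)) ≡⟨ perturbed-copies J (s + t) s+t≤ ⟩
    pd (2 ^ J * 1 + (s + t))          ≡⟨ cong pd (sym (+-assoc (2 ^ J * 1) s t)) ⟩
    pd (2 ^ J * 1 + s + t)            ∎
    where
    open ≡-Reasoning
    t≤ones : t ≤ ones J
    t≤ones = ≤-pred (subst (suc t ≤_) (sym (1+ones≡2^ J)) (≤-trans t<W W≤K))
    s+t≤ : s + t ≤ double (ones J)
    s+t≤ = subst (s + t ≤_) (sym (double≡+ (ones J))) (+-mono-≤ s≤ones t≤ones)

-- At an even position 2p' the odd offsets of the block, read through pd (2n+1) = ¬ pd n,
-- give an occurrence of the previous block at p'; at an odd position the even offsets,
-- which are 0 in the block, force 11 in pd at p', as does the level-0 block itself.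
defect-block-not-in-pd : ∀ J p → ¬ (∀ t → t ≤ defect J → pd (p + t) ≡ perturbed J (2 ^ J * 1 + t))
defect-block-not-in-pd zero p occurs = pd-no-11 p pd-p≡true pd-1+p≡true
  where
  open ≡-Reasoning
  pd-p≡true : pd p ≡ true
  pd-p≡true = begin
    pd p       ≡⟨ cong pd (sym (+-identityʳ p)) ⟩
    pd (p + 0) ≡⟨ occurs 0 z≤n ⟩
    pd 1       ≡⟨ pd-1 ⟩
    true       ∎
  pd-1+p≡true : pd (suc p) ≡ true
  pd-1+p≡true = begin
    pd (suc p)  ≡⟨ cong pd (+-comm 1 p) ⟩
    pd (p + 1)  ≡⟨ occurs 1 (s≤s z≤n) ⟩
    not (pd 2)  ≡⟨ cong not (pd-double 1) ⟩
    true        ∎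
defect-block-not-in-pd (suc J) p occurs with evenOrOdd p
... | inj₁ (p' , refl) = defect-block-not-in-pd J p' λ t t≤ → not-injective (begin
  not (pd (p' + t))                                ≡⟨ sym (pd-1+double (p' + t)) ⟩
  pd (suc (double (p' + t)))                       ≡⟨ cong pd (sym (double+1+double p' t)) ⟩
  pd (double p' + suc (double t))                  ≡⟨ occurs (suc (double t)) (1+double-≤ t≤) ⟩
  perturbed (suc J) (2 ^ suc J * 1 + suc (double t)) ≡⟨ cong (perturbed (suc J)) (block-1+double J 1 t) ⟩
  perturbed (suc J) (suc (double (2 ^ J * 1 + t))) ≡⟨ perturbed-1+double J (2 ^ J * 1 + t) ⟩
  not (perturbed J (2 ^ J * 1 + t))                ∎)
  where
  open ≡-Reasoning
  1+double-≤ : ∀ {t} → t ≤ defect J → suc (double t) ≤ defect (suc J)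
  1+double-≤ {t} t≤ = subst (suc (double t) ≤_) (sym (defect-suc J)) (s≤s (double-mono-≤ t≤))
... | inj₂ (p' , refl) = pd-no-11 p'
  (trans (cong pd (sym (+-identityʳ p'))) (odd-offsets-true 0 z≤n))
  (trans (cong pd (+-comm 1 p')) (odd-offsets-true 1 2≤defect))
  where
  open ≡-Reasoning
  2≤defect : 2 ≤ defect (suc J)
  2≤defect = subst (2 ≤_) (sym (defect-suc J)) (s≤s (≤-trans (1≤defect J) (m≤double (defect J))))
  odd-offsets-true : ∀ t → double t ≤ defect (suc J) → pd (p' + t) ≡ true
  odd-offsets-true t t≤ = not-injective (begin
    not (pd (p' + t))                          ≡⟨ sym (pd-1+double (p' + t)) ⟩
    pd (suc (double (p' + t)))                 ≡⟨ cong (pd ∘ suc) (double-+ p' t) ⟩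
    pd (suc (double p') + double t)            ≡⟨ occurs (double t) t≤ ⟩
    perturbed (suc J) (2 ^ suc J * 1 + double t) ≡⟨ cong (perturbed (suc J)) (block-double J 1 t) ⟩
    perturbed (suc J) (double (2 ^ J * 1 + t)) ≡⟨ perturbed-double J (2 ^ J * 1 + t) ⟩
    false                                      ∎)

module BinaryAlphabet (k : ℕ) where

  encode : Bool → Fin (suc (suc k))
  encode false = Fin.zero
  encode true  = Fin.suc Fin.zero

  encode-injective : ∀ {a b} → encode a ≡ encode b → a ≡ b
  encode-injective {false} {false} _ = refl
  encode-injective {true}  {true}  _ = refl

  pdSequence : Seq (suc (suc k))
  pdSequence n = encode (pd n)

  recurrenceBound : ℕ → ℕ
  recurrenceBound L = 2 ^ (3 + L)

  pdSequence-recurrent : UniformlyRecurrent pdSequence recurrenceBound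
  pdSequence-recurrent x p o w with pd-recurrent (length x) p w
  ... | p' , w≤p' , p'+∣x∣≤ , agree = p' , w≤p' , p'+∣x∣≤ ,
    occursAt-transport pdSequence pdSequence x p p' (λ t t<∣x∣ → cong encode (sym (agree t t<∣x∣))) o

  module Perturbed (N : ℕ) where

    J : ℕ
    J = 3 + N

    perturbedSequence : Seq (suc (suc k))
    perturbedSequence n = encode (perturbed J n)

    N<2^J : N < 2 ^ J * 1
    N<2^J = subst (N <_) (sym (*-identityʳ (2 ^ J))) (≤-trans (s≤s (m≤n+m N 3)) (n<2^n J))

    equal-beyond-defect : ∀ n → defect J < n → perturbedSequence n ≡ pdSequence n
    equal-beyond-defect n defect<n = cong encode (perturbed-≢ J n (>⇒≢ defect<n))

    equal-below-N : ∀ n → n < N → pdSequence n ≡ perturbedSequence n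
    equal-below-N n n<N = cong encode (sym (perturbed-≢ J n (<⇒≢ (<-≤-trans n<N N≤defect))))
      where
      N≤defect : N ≤ defect J
      N≤defect = ≤-trans (<⇒≤ N<2^J)
        (≤-trans (*-monoʳ-≤ (2 ^ J) (s≤s z≤n)) (m≤m+n (2 ^ J * 2) (ones J)))

    short-windows : ∀ i W → W ≤ 2 ^ J →
      ∃ λ i' → ∀ t → t < W → perturbedSequence (i + t) ≡ pdSequence (i' + t)
    short-windows i W W≤ with perturbed-windows J i W W≤
    ... | i' , same = i' , λ t t<W → cong encode (same t t<W)

    open Perturbation {u = pdSequence} {v = perturbedSequence} {D = defect J} {N = N} {B = 2 ^ J}
      pdSequence-recurrent
      equal-beyond-defect
      short-windows
      (≤-trans (<⇒≤ (n<2^n N)) (^-monoʳ-≤ 2 (m≤n+m N 3)))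
      (λ L L≤N → ^-monoʳ-≤ 2 (+-monoʳ-≤ 3 L≤N))
      public

    early-suffix-¬SAP : ∀ m → m ≤ 2 ^ J * 1 → ¬ SAP (suffix perturbedSequence m)
    early-suffix-¬SAP m m≤ = ¬SAP-transient perturbedSequence m (defect J) block factor transient
      where
      start : ℕ
      start = 2 ^ J * 1
      block : Str (suc (suc k))
      block = window perturbedSequence start (suc (defect J))
      block-occurs : OccursAt perturbedSequence block start
      block-occurs = occursAt-window perturbedSequence start (suc (defect J))
      factor : IsFactor (suffix perturbedSequence m) block
      factor = start ∸ m , occursAt⇒suffix perturbedSequence block m (start ∸ m)
        (subst (OccursAt perturbedSequence block) (sym (m+[n∸m]≡n m≤)) block-occurs)
      transient : ∀ q → defect J < q → ¬ OccursAt perturbedSequence block q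
      transient q defect<q o = defect-block-not-in-pd J q λ t t≤ → encode-injective
        (occursAt-agree pdSequence perturbedSequence block q start
          (occursAt-beyond⇒u block q defect<q o) block-occurs t
          (subst (t <_) (sym (length-applyUpTo (λ t → perturbedSequence (start + t)) (suc (defect J))))
            (s≤s t≤)))

    pr-large : ∀ m → IsPr perturbedSequence m → N < m
    pr-large m (sap , _) = ≰⇒> λ m≤N → early-suffix-¬SAP m (≤-trans m≤N (<⇒≤ N<2^J)) sap

theorem6 : (k : ℕ) → 2 ≤ k →
    ¬ (Σ OracleAlgorithm λ A →
         (ω : Seq k) (f : ℕ → ℕ) → EventuallySAP ω → IsRegulator ω f →
           ∃ λ l → HaltsWith A ω f l × (∀ m → IsPr ω m → m ≤ l))
theorem6 (suc (suc k)) (s≤s (s≤s z≤n)) (A , correct) =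
  ¬¬-least (suc (defect J)) suffix-SAP λ (m , isPr) → <⇒≱ (pr-large m isPr) (begin
    m      ≤⟨ bounded m isPr ⟩
    l'     ≡⟨ l'≡l ⟩
    l      ≤⟨ m≤n+m l b ⟩
    b + l  ∎)
  where
  open BinaryAlphabet k
  open ≤-Reasoning
  run₀ : ∃ λ l → HaltsWith A pdSequence recurrenceBound l × (∀ m → IsPr pdSequence m → m ≤ l)
  run₀ = correct pdSequence recurrenceBound
           (0 , recurrent⇒SAP {ω = pdSequence} {recurrenceBound} pdSequence-recurrent)
           (recurrent⇒isRegulator {ω = pdSequence} {recurrenceBound} pdSequence-recurrent)
  l : ℕ
  l = proj₁ run₀
  b : ℕ
  b = proj₁ (HaltsWith-local (proj₁ (proj₂ run₀)))
  open Perturbed (b + l)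
  fooled : HaltsWith A perturbedSequence regulator l
  fooled = proj₂ (HaltsWith-local (proj₁ (proj₂ run₀))) perturbedSequence regulator
    (λ i i<b → equal-below-N i (≤-trans i<b (m≤m+n b l)))
    (λ i i<b → sym (regulator-short i (<⇒≤ (≤-trans i<b (m≤m+n b l)))))
  run₁ : ∃ λ l' → HaltsWith A perturbedSequence regulator l' × (∀ m → IsPr perturbedSequence m → m ≤ l')
  run₁ = correct perturbedSequence regulator (suc (defect J) , suffix-SAP) isRegulator
  l' : ℕ
  l' = proj₁ run₁
  bounded : ∀ m → IsPr perturbedSequence m → m ≤ l'
  bounded = proj₂ (proj₂ run₁)
  l'≡l : l' ≡ l
  l'≡l = HaltsWith-functional (proj₁ (proj₂ run₁)) fooled
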